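{- Let $p$ be an odd prime and $k>1$ an integer. Then for every integer $h$ with $1\leq h<k$, the integer $\frac12\sum_{i=1}^{2k}p^{2k-i}-h$ does not lie in the image of $Z_{p^2}:\mathbb{N}\to\mathbb{N}$.
   Context: For an integer $b\geq 2$, $Z_b(m)$ denotes the number of trailing zeroes in the base $b$ expansion of $m!$. -}

module Defs where

open import Data.Nat using (ℕ; _!; zero; suc; _+_; _*_; _^_; _∸_; _≤_; _<_; NonZero; _/_; _%_)
open import Data.Nat.Properties using (_≟_)
open import Data.List using (List; map; upTo)
open import Data.Nat.ListAction using (sum)
open import Relation.Nullary using (yes; no)

-- Fuel f bounds the steps;
-- fuel n suffices since each strip at least halves a positive n.
trailingZerosFuel : (b : ℕ) → .{{NonZero b}} → ℕ → ℕ → ℕ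
trailingZerosFuel b zero n = 0
trailingZerosFuel b (suc f) zero = 0
trailingZerosFuel b (suc f) (suc n) with (suc n) % b ≟ 0
... | yes _ = suc (trailingZerosFuel b f (suc n / b))
... | no _ = 0

trailingZeros : (b : ℕ) → .{{NonZero b}} → ℕ → ℕ
trailingZeros b n = trailingZerosFuel b n n

-- Z_b(m): number of trailing zeroes in the base-b expansion of m!
-- (only meaningful for b ≥ 2; the b = 0 case is a dummy value)
Z : ℕ → ℕ → ℕ
Z zero m = 0
Z (suc b) m = trailingZeros (suc b) (m !)

S : ℕ → ℕ → ℕ
S p k = sum (map (λ i → p ^ (2 * k ∸ i)) (map suc (upTo (2 * k))))

-- Write n = 2k and Σ = p^(n-1) + ... + p + 1 = 2N.  By Legendre, v_p((p^n)!) = Σ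
-- and v_p((p^n - 1)!) = Σ - n, so v_p(m!) never takes a value in the window
-- (Σ - n, Σ): it is at most Σ - n for m < p^n and at least Σ for m ≥ p^n.
-- Since Z_{p²}(m) = ⌊v_p(m!)/2⌋, the value N - h would force
-- Σ - 2h ≤ v_p(m!) ≤ Σ - 2h + 1, and 1 ≤ h < k puts both values inside the window.
module Submission where

open import Defs
open import Data.Nat using (ℕ; _*_; _^_; _∸_; _%_; _≤_; _<_)
open import Data.Nat.Primality using (Prime)
open import Data.Product using (∃)
open import Relation.Binary.PropositionalEquality using (_≡_)
open import Relation.Nullary using (¬_)

open import Data.Nat.Properties
open import Algebra.Properties.CommutativeSemigroup *-commutativeSemigroup using (x∙yz≈y∙xz)
open import Data.Empty using (⊥)
open import Data.List using (_∷_; map; upTo; applyUpTo; downFrom)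
open import Data.List.Properties using (map-∘; map-upTo; map-applyUpTo; map-cong; map-id)
open import Data.Nat using (zero; suc; pred; _+_; _!; _/_; NonZero; z≤n; s≤s; z<s; nonTrivial⇒n>1)
open import Data.Nat.Divisibility
open import Data.Nat.DivMod using (m*[n/m]≡n; m/n<m; m≥n⇒m/n>0)
open import Data.Nat.ListAction using (sum)
open import Data.Nat.Primality using (euclidsLemma; prime⇒nonZero; prime⇒nonTrivial)
open import Data.Nat.Solver using (module +-*-Solver)
open import Data.Product using (_,_; _×_; proj₁; proj₂)
open import Data.Sum using (_⊎_; inj₁; inj₂; [_,_])
open import Function using (_∘_)
open import Relation.Binary.PropositionalEquality
  using (refl; sym; trans; cong; cong₂; subst; subst₂; module ≡-Reasoning)
open import Relation.Nullary using (yes; no; contradiction)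

open +-*-Solver using (solve; _:*_; _:=_)

ExactPower : ℕ → ℕ → ℕ → Set
ExactPower b e n = b ^ e ∣ n × ¬ b ^ suc e ∣ n

exactPower-zero : ∀ {b n} → ¬ b ∣ n → ExactPower b 0 n
exactPower-zero {b} {n} b∤n = 1∣ n , b∤n ∘ subst (_∣ n) (*-identityʳ b)

exactPower-* : ∀ {b e n} .{{_ : NonZero b}} → ExactPower b e n → ExactPower b (suc e) (b * n)
exactPower-* {b} (bᵉ∣n , bᵉ⁺¹∤n) = *-monoʳ-∣ b bᵉ∣n , bᵉ⁺¹∤n ∘ *-cancelˡ-∣ b

trailingZerosFuel-exact : ∀ {b} .{{_ : NonZero b}} → 1 < b → ∀ f n → 0 < n → n ≤ f →
                          ExactPower b (trailingZerosFuel b f n) n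
trailingZerosFuel-exact {b} 1<b (suc f) (suc n) _ (s≤s n≤f) with suc n % b ≟ 0
... | no  b∤1+n = exactPower-zero (b∤1+n ∘ n∣m⇒m%n≡0 (suc n) b)
... | yes 1+n%b≡0 = subst (ExactPower b (suc t)) b*q≡1+n (exactPower-* {e = t} q-exact)
  where
  b∣1+n : b ∣ suc n
  b∣1+n = m%n≡0⇒n∣m (suc n) b 1+n%b≡0
  q : ℕ
  q = suc n / b
  b*q≡1+n : b * q ≡ suc n
  b*q≡1+n = m*[n/m]≡n b∣1+n
  t : ℕ
  t = trailingZerosFuel b f q
  q-exact : ExactPower b t q
  q-exact = trailingZerosFuel-exact 1<b f q (m≥n⇒m/n>0 (∣⇒≤ b∣1+n))
              (≤-trans (≤-pred (m/n<m (suc n) b 1<b)) n≤f)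

Z-exact : ∀ {b} → 1 < b → ∀ m → ExactPower b (Z b m) (m !)
Z-exact {suc b} 1<b m = trailingZerosFuel-exact 1<b (m !) (m !) (1≤n! m) ≤-refl

Z-square-exact : ∀ {p} → 1 < p → ∀ m →
                 p ^ (2 * Z (p ^ 2) m) ∣ m ! × ¬ p ^ (2 * suc (Z (p ^ 2) m)) ∣ m !
Z-square-exact {p} 1<p m with Z-exact (^-monoʳ-< p 1<p (z<s {1})) m
... | p²ᶻ∣m! , p²ᶻ⁺²∤m! = subst (_∣ m !) (^-*-assoc p 2 z) p²ᶻ∣m!
                        , p²ᶻ⁺²∤m! ∘ subst (_∣ m !) (sym (^-*-assoc p 2 (suc z)))
  where
  z : ℕ
  z = Z (p ^ 2) m

^-monoʳ-∣ : ∀ p {d e} → d ≤ e → p ^ d ∣ p ^ e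
^-monoʳ-∣ p {d} {e} d≤e = divides (p ^ (e ∸ d)) (begin
  p ^ e               ≡⟨ cong (p ^_) (m+[n∸m]≡n d≤e) ⟨
  p ^ (d + (e ∸ d))   ≡⟨ ^-distribˡ-+-* p d (e ∸ d) ⟩
  p ^ d * p ^ (e ∸ d) ≡⟨ *-comm (p ^ d) _ ⟩
  p ^ (e ∸ d) * p ^ d ∎)
  where open ≡-Reasoning

^∣^*-coprime⇒≤ : ∀ {p r d e} .{{_ : NonZero p}} → ¬ p ∣ r → p ^ e ∣ p ^ d * r → e ≤ d
^∣^*-coprime⇒≤ {p} {r} {d} {e} p∤r pᵉ∣pᵈr with e ≤? d
... | yes e≤d = e≤d
... | no  e≰d = contradiction (*-cancelˡ-∣ (p ^ d) {{m^n≢0 p d}} pᵈp∣pᵈr) p∤r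
  where
  pᵈp∣pᵈr : p ^ d * p ∣ p ^ d * r
  pᵈp∣pᵈr = subst (_∣ p ^ d * r) (*-comm p (p ^ d))
                  (∣-trans (^-monoʳ-∣ p (≰⇒> e≰d)) pᵉ∣pᵈr)

m<n⇒n*m!∣n! : ∀ {m n} → m < n → n * m ! ∣ n !
m<n⇒n*m!∣n! {n = suc n} (s≤s m≤n) = *-monoʳ-∣ (suc n) (m≤n⇒m!∣n! m≤n)

powerSum : ℕ → ℕ → ℕ
powerSum p n = sum (map (p ^_) (downFrom n))

n≤powerSum : ∀ p .{{_ : NonZero p}} n → n ≤ powerSum p n
n≤powerSum p zero    = z≤n
n≤powerSum p (suc n) = +-mono-≤ (m^n>0 p n) (n≤powerSum p n)

applyUpTo-reflect : ∀ n → applyUpTo (λ i → n ∸ suc i) n ≡ downFrom n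
applyUpTo-reflect n = begin
  applyUpTo (λ i → n ∸ suc i) n     ≡⟨ cong (λ c → applyUpTo (λ i → c ∸ suc i) n)
                                               (+-identityʳ n) ⟨
  applyUpTo (λ i → n + 0 ∸ suc i) n ≡⟨ shifted 0 n ⟩
  map (_+ 0) (downFrom n)           ≡⟨ map-cong +-identityʳ (downFrom n) ⟩
  map (λ i → i) (downFrom n)        ≡⟨ map-id (downFrom n) ⟩
  downFrom n                        ∎
  where
  open ≡-Reasoning
  shifted : ∀ m n → applyUpTo (λ i → n + m ∸ suc i) n ≡ map (_+ m) (downFrom n)
  shifted m zero    = refl
  shifted m (suc n) = cong (n + m ∷_) (shifted m n)

S≡powerSum : ∀ p k → S p k ≡ powerSum p (2 * k)
S≡powerSum p k = cong sum (begin
  map (λ i → p ^ (n ∸ i)) (map suc (upTo n)) ≡⟨ map-∘ (upTo n) ⟨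
  map (λ i → p ^ (n ∸ suc i)) (upTo n)       ≡⟨ map-upTo _ n ⟩
  applyUpTo (λ i → p ^ (n ∸ suc i)) n        ≡⟨ map-applyUpTo _ (p ^_) n ⟨
  map (p ^_) (applyUpTo (λ i → n ∸ suc i) n) ≡⟨ cong (map (p ^_)) (applyUpTo-reflect n) ⟩
  map (p ^_) (downFrom n)                    ∎)
  where
  open ≡-Reasoning
  n = 2 * k

∤-*-prime : ∀ {p m n} → Prime p → ¬ p ∣ m → ¬ p ∣ n → ¬ p ∣ m * n
∤-*-prime {m = m} {n} pr p∤m p∤n = [ p∤m , p∤n ] ∘ euclidsLemma m n pr

∤-*+ : ∀ {p a c} → 0 < c → c < p → ¬ p ∣ p * a + c
∤-*+ {p} {a} {suc c} _ c<p p∣pa+c = <⇒≱ c<p (∣⇒≤ (∣m+n∣m⇒∣n p∣pa+c (m∣m*n a)))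

module _ {p} (pr : Prime p) where

  private instance
    p≢0 : NonZero p
    p≢0 = prime⇒nonZero pr

  p∤1 : ¬ p ∣ 1
  p∤1 p∣1 = <⇒≢ (nonTrivial⇒n>1 p {{prime⇒nonTrivial pr}}) (sym (∣1⇒≡1 p∣1))

  factorial-+-coprime : ∀ a c → c < p → ∃ λ r → (p * a + c) ! ≡ (p * a) ! * r × ¬ p ∣ r
  factorial-+-coprime a zero    _   =
    1 , trans (cong _! (+-identityʳ (p * a))) (sym (*-identityʳ _)) , p∤1
  factorial-+-coprime a (suc c) c<p with factorial-+-coprime a c (<⇒≤ c<p)
  ... | r , eq , p∤r = (p * a + suc c) * r , eq′ , ∤-*-prime pr (∤-*+ z<s c<p) p∤r
    where
    open ≡-Reasoning
    eq′ : (p * a + suc c) ! ≡ (p * a) ! * ((p * a + suc c) * r)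
    eq′ = begin
      (p * a + suc c) !                 ≡⟨ cong _! (+-suc (p * a) c) ⟩
      suc (p * a + c) * (p * a + c) !   ≡⟨ cong₂ _*_ (sym (+-suc (p * a) c)) eq ⟩
      (p * a + suc c) * ((p * a) ! * r) ≡⟨ x∙yz≈y∙xz (p * a + suc c) ((p * a) !) r ⟩
      (p * a) ! * ((p * a + suc c) * r) ∎

  factorial-* : ∀ a → ∃ λ r → (p * a) ! ≡ p ^ a * a ! * r × ¬ p ∣ r
  factorial-* zero    = 1 , cong _! (*-zeroʳ p) , p∤1
  factorial-* (suc a)
    with factorial-* a | factorial-+-coprime a (pred p) (≤-reflexive (suc-pred p))
  ... | r₀ , eq₀ , p∤r₀ | r₁ , eq₁ , p∤r₁ =
    r₀ * r₁ , eq , ∤-*-prime pr p∤r₀ p∤r₁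
    where
    open ≡-Reasoning
    p[1+a]≡1+[pa+p-1] : p * suc a ≡ suc (p * a + pred p)
    p[1+a]≡1+[pa+p-1] = begin
      p * suc a            ≡⟨ *-suc p a ⟩
      p + p * a            ≡⟨ +-comm p (p * a) ⟩
      p * a + p            ≡⟨ cong (p * a +_) (suc-pred p) ⟨
      p * a + suc (pred p) ≡⟨ +-suc (p * a) (pred p) ⟩
      suc (p * a + pred p) ∎
    eq : (p * suc a) ! ≡ p ^ suc a * suc a ! * (r₀ * r₁)
    eq = begin
      (p * suc a) !                             ≡⟨ cong _! p[1+a]≡1+[pa+p-1] ⟩
      suc (p * a + pred p) * (p * a + pred p) ! ≡⟨ cong₂ _*_ (sym p[1+a]≡1+[pa+p-1]) eq₁ ⟩
      p * suc a * ((p * a) ! * r₁)              ≡⟨ cong (λ x → p * suc a * (x * r₁)) eq₀ ⟩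
      p * suc a * (p ^ a * a ! * r₀ * r₁)       ≡⟨ solve 6 (λ p s x f r₀ r₁ →
                                                     p :* s :* (x :* f :* r₀ :* r₁)
                                                       := p :* x :* (s :* f) :* (r₀ :* r₁))
                                                     refl p (suc a) (p ^ a) (a !) r₀ r₁ ⟩
      p ^ suc a * suc a ! * (r₀ * r₁)           ∎

  factorial-^ : ∀ n → ∃ λ r → (p ^ n) ! ≡ p ^ powerSum p n * r × ¬ p ∣ r
  factorial-^ zero    = 1 , refl , p∤1
  factorial-^ (suc n) with factorial-^ n | factorial-* (p ^ n)
  ... | r₀ , eq₀ , p∤r₀ | r₁ , eq₁ , p∤r₁ =
    r₀ * r₁ , eq , ∤-*-prime pr p∤r₀ p∤r₁
    where
    open ≡-Reasoning
    eq : (p ^ suc n) ! ≡ p ^ (p ^ n + powerSum p n) * (r₀ * r₁)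
    eq = begin
      (p * p ^ n) !                              ≡⟨ eq₁ ⟩
      p ^ (p ^ n) * (p ^ n) ! * r₁               ≡⟨ cong (λ x → p ^ (p ^ n) * x * r₁) eq₀ ⟩
      p ^ (p ^ n) * (p ^ powerSum p n * r₀) * r₁ ≡⟨ solve 4 (λ x y r₀ r₁ →
                                                      x :* (y :* r₀) :* r₁ := x :* y :* (r₀ :* r₁))
                                                      refl (p ^ (p ^ n)) (p ^ powerSum p n) r₀ r₁ ⟩
      p ^ (p ^ n) * p ^ powerSum p n * (r₀ * r₁) ≡⟨ cong (_* (r₀ * r₁))
                                                         (^-distribˡ-+-* p (p ^ n) (powerSum p n)) ⟨
      p ^ (p ^ n + powerSum p n) * (r₀ * r₁)     ∎

  factorial-valuation-gap : ∀ n m →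
    (∀ {e} → p ^ e ∣ m ! → n + e ≤ powerSum p n) ⊎ p ^ powerSum p n ∣ m !
  factorial-valuation-gap n m with factorial-^ n | p ^ n ≤? m
  ... | r , eq , _   | yes pⁿ≤m =
    inj₂ (∣-trans (subst (p ^ powerSum p n ∣_) (sym eq) (m∣m*n r)) (m≤n⇒m!∣n! pⁿ≤m))
  ... | r , eq , p∤r | no  pⁿ≰m = inj₁ λ {e} pᵉ∣m! → ^∣^*-coprime⇒≤ p∤r
    (subst₂ _∣_ (sym (^-distribˡ-+-* p n e)) eq
      (∣-trans (*-monoʳ-∣ (p ^ n) pᵉ∣m!) (m<n⇒n*m!∣n! (≰⇒> pⁿ≰m))))

corollary2 : (p k : ℕ) → Prime p → p % 2 ≡ 1 → 1 < k →
    (h : ℕ) → 1 ≤ h → h < k →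
    (N : ℕ) → 2 * N ≡ S p k →
    ¬ (∃ λ m → Z (p ^ 2) m ≡ N ∸ h)
corollary2 p k pr _ _ h 1≤h h<k N 2N≡S (m , Zm≡t) =
  [ below-window , above-window ] (factorial-valuation-gap pr (2 * k) m)
  where
  instance
    p≢0 : NonZero p
    p≢0 = prime⇒nonZero pr
  t : ℕ
  t = N ∸ h
  Σ≡2N : powerSum p (2 * k) ≡ 2 * N
  Σ≡2N = sym (trans 2N≡S (S≡powerSum p k))
  t+h≡N : t + h ≡ N
  t+h≡N = m∸n+n≡m (≤-trans (<⇒≤ h<k) k≤N)
    where
    k≤N : k ≤ N
    k≤N = *-cancelˡ-≤ 2 (subst (2 * k ≤_) Σ≡2N (n≤powerSum p (2 * k)))
  exact : p ^ (2 * t) ∣ m ! × ¬ p ^ (2 * suc t) ∣ m !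
  exact = subst (λ z → p ^ (2 * z) ∣ m ! × ¬ p ^ (2 * suc z) ∣ m !) Zm≡t
                (Z-square-exact (nonTrivial⇒n>1 p {{prime⇒nonTrivial pr}}) m)
  below-window : (∀ {e} → p ^ e ∣ m ! → 2 * k + e ≤ powerSum p (2 * k)) → ⊥
  below-window bound = <⇒≱ h<k (+-cancelˡ-≤ t k h (subst (t + k ≤_) (sym t+h≡N) t+k≤N))
    where
    2[t+k]≡2k+2t : 2 * (t + k) ≡ 2 * k + 2 * t
    2[t+k]≡2k+2t = trans (*-distribˡ-+ 2 t k) (+-comm (2 * t) (2 * k))
    t+k≤N : t + k ≤ N
    t+k≤N = *-cancelˡ-≤ 2 (subst₂ _≤_ (sym 2[t+k]≡2k+2t) Σ≡2N (bound (proj₁ exact)))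
  above-window : p ^ powerSum p (2 * k) ∣ m ! → ⊥
  above-window pΣ∣m! = proj₂ exact (∣-trans (^-monoʳ-∣ p (*-monoʳ-≤ 2 1+t≤N)) p²ᴺ∣m!)
    where
    p²ᴺ∣m! : p ^ (2 * N) ∣ m !
    p²ᴺ∣m! = subst (λ e → p ^ e ∣ m !) Σ≡2N pΣ∣m!
    1+t≤N : suc t ≤ N
    1+t≤N = subst (suc t ≤_) t+h≡N (subst (_≤ t + h) (+-comm t 1) (+-monoʳ-≤ t 1≤h))
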